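{- Let $G$ be a strong bicentral $2$-tree on $n\ge 6$ vertices with tail set $\{2,3\}$ and exactly two tail vertices of degree $3$. Let $a,b$ be the core vertices, $T=V(G)\setminus\{a,b\}$ and $S=N(a)\cap N(b)\cap T$. Then $|S|=n-4$.
   Context: A $2$-tree is a graph obtained from the triangle $K_3$ by repeatedly adding a new vertex adjacent to both endpoints of an existing edge. For $r\in\{1,2,3\}$ and an integer $\Delta\ge 2$, a $2$-tree on $n$ vertices is $r$-central with maximum degree $\Delta$ if $\Delta$ is its maximum degree and exactly $r$ vertices have degree $\Delta$; these $r$ vertices form the core and the other $n-r$ vertices form the tail. It is strong if the core induces $K_r$. It has tail set $\{2,3\}$ if every tail vertex has degree $2$ or $3$. "Bicentral" means $2$-central. $N(w)$ denotes the set of neighbours of $w$. -}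

module Defs where

open import Data.Nat using (ℕ; zero; suc; _+_; _<_; _∸_; _≤_)
open import Data.Bool using (Bool; true; false; _∨_; _∧_; not; if_then_else_)
open import Data.Fin using (Fin; zero; suc; _≟_)
open import Data.Fin.Permutation using (Permutation′; _⟨$⟩ʳ_)
open import Data.List using (List; allFin; filter; length)
open import Data.Product using (∃; _×_)
open import Data.Sum using (_⊎_)
open import Relation.Nullary using (¬_)
open import Relation.Nullary.Decidable using (⌊_⌋)
open import Relation.Binary.PropositionalEquality using (_≡_; _≢_)

Graph : ℕ → Set
Graph n = Fin n → Fin n → Bool

_==_ : ∀ {n} → Fin n → Fin n → Bool
u == v = ⌊ u ≟ v ⌋

K₃ : Graph 3
K₃ u v = not (u == v)

extend : ∀ {n} → Graph n → Fin n → Fin n → Graph (suc n)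
extend G x y zero    zero    = false
extend G x y zero    (suc v) = (v == x) ∨ (v == y)
extend G x y (suc u) zero    = (u == x) ∨ (u == y)
extend G x y (suc u) (suc v) = G u v

data TwoTreeC : (n : ℕ) → Graph n → Set where
  triangle : TwoTreeC 3 K₃
  add      : ∀ {n} {G : Graph n} → TwoTreeC n G →
             (x y : Fin n) → G x y ≡ true →
             TwoTreeC (suc n) (extend G x y)

IsTwoTree : ∀ {n} → Graph n → Set
IsTwoTree {n} G = ∃ λ (σ : Permutation′ n) → ∃ λ (H : Graph n) →
  TwoTreeC n H × (∀ u v → G (σ ⟨$⟩ʳ u) (σ ⟨$⟩ʳ v) ≡ H u v)

countV : ∀ {n} → (Fin n → Bool) → ℕ
countV {n} p = length (filter (λ v → p v ≟ᵇ true) (allFin n))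
  where
  open import Data.Bool using () renaming (_≟_ to _≟ᵇ_)

deg : ∀ {n} → Graph n → Fin n → ℕ
deg G v = countV (G v)

isTail : ∀ {n} → Fin n → Fin n → Fin n → Bool
isTail a b v = not (v == a) ∧ not (v == b)

record StrongBicentralCore {n} (G : Graph n) (a b : Fin n) : Set where
  field
    distinct : a ≢ b
    sameDeg  : deg G a ≡ deg G b
    tailLess : ∀ v → v ≢ a → v ≢ b → deg G v < deg G a
    strong   : G a b ≡ true
    tailSet  : ∀ v → v ≢ a → v ≢ b → (deg G v ≡ 2) ⊎ (deg G v ≡ 3)

{-# OPTIONS --safe #-}
-- A 2-tree on n vertices has 2n − 3 edges, so its degrees sum to 4n − 6. The
-- n − 2 tail vertices contribute 2(n − 2) + 2, which leaves n − 2 for each core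
-- vertex. As a and b are adjacent, each of them therefore misses exactly one tail
-- vertex. No tail vertex x is missed by both: its triangle x y z lies in the tail,
-- y is adjacent to a and b because x is the only tail vertex either one misses, and
-- then y has the four neighbours a, b, x, z. So the tail is S plus two vertices.
module Submission where

open import Defs
open import Data.Nat using (ℕ; _≤_; _∸_)
open import Data.Fin using (Fin)
open import Data.Bool using (_∧_)
open import Relation.Nullary.Decidable using (⌊_⌋)
open import Relation.Binary.PropositionalEquality using (_≡_)

open import Data.Nat using (zero; suc; _+_; _*_; z≤n; s≤s)
open import Data.Nat.Properties
  using (+-0-commutativeMonoid; +-identityʳ; +-assoc; +-comm; *-suc; +-cancelˡ-≡; +-cancelʳ-≡;
         *-cancelˡ-≡; ≤-trans; <-irrefl; m≤n+m; +-mono-≤; m+n∸n≡m)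
open import Data.Nat.Tactic.RingSolver using (solve-∀)
open import Data.Fin using (_≟_) renaming (zero to fzero; suc to fsuc)
open import Data.Fin.Properties using (suc-injective)
open import Data.Fin.Permutation using (Permutation′; _⟨$⟩ʳ_; _⟨$⟩ˡ_; inverseʳ; inverseˡ)
open import Data.Bool using (Bool; true; false; not; _∨_; if_then_else_)
import Data.Bool as Bool
open import Data.Bool.Properties using (∧-zeroʳ; ∨-zeroʳ; not-injective)
open import Data.List using (filter; length; tabulate)
open import Data.Product using (_×_; _,_; ∃₂)
open import Data.Sum using (_⊎_; inj₁; inj₂)
open import Data.Empty using (⊥; ⊥-elim)
open import Function using (_∘_)
open import Relation.Nullary using (yes; no; contradiction)
open import Relation.Nullary.Decidable using (isYes≗does; dec-true; dec-false)
open import Relation.Binary.PropositionalEquality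
  using (_≢_; refl; sym; trans; cong; cong₂; subst; module ≡-Reasoning)
open import Algebra.Properties.CommutativeMonoid.Sum +-0-commutativeMonoid
  using (sum; sum-cong-≗; sum-replicate-zero; ∑-distrib-+; ∑-permute)

open ≡-Reasoning

==-refl : ∀ {n} (u : Fin n) → (u == u) ≡ true
==-refl u = trans (isYes≗does (u ≟ u)) (dec-true (u ≟ u) refl)

≢⇒==-false : ∀ {n} {u v : Fin n} → u ≢ v → (u == v) ≡ false
≢⇒==-false {u = u} {v} u≢v = trans (isYes≗does (u ≟ v)) (dec-false (u ≟ v) u≢v)

==-sym : ∀ {n} (u v : Fin n) → (u == v) ≡ (v == u)
==-sym u v with u ≟ v | v ≟ u
... | yes _   | yes _   = refl
... | no _    | no _    = refl
... | yes u≡v | no v≢u  = contradiction (sym u≡v) v≢u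
... | no u≢v  | yes v≡u = contradiction (sym v≡u) u≢v

module _ {n} {a b v : Fin n} where

  isTail-≢ˡ : isTail a b v ≡ true → v ≢ a
  isTail-≢ˡ t refl with () ← trans (sym t) (cong (λ c → not c ∧ not (v == b)) (==-refl a))

  isTail-≢ʳ : isTail a b v ≡ true → v ≢ b
  isTail-≢ʳ t refl
    with () ← trans (sym t) (trans (cong (λ c → not (v == a) ∧ not c) (==-refl b)) (∧-zeroʳ _))

  ≢⇒isTail : v ≢ a → v ≢ b → isTail a b v ≡ true
  ≢⇒isTail v≢a v≢b rewrite ≢⇒==-false v≢a | ≢⇒==-false v≢b = refl

indicator : Bool → ℕ
indicator b = if b then 1 else 0

indicator≤1 : ∀ b → indicator b ≤ 1
indicator≤1 true  = s≤s z≤n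
indicator≤1 false = z≤n

indicator-∧ : ∀ b c → (if b then indicator c else 0) ≡ indicator (b ∧ c)
indicator-∧ true  c = refl
indicator-∧ false c = refl

count : ∀ {n} → (Fin n → Bool) → ℕ
count p = sum (indicator ∘ p)

countV≡count : ∀ {n} (p : Fin n → Bool) → countV p ≡ count p
countV≡count {n} p = go n (λ v → v)
  where
  go : ∀ k (f : Fin k → Fin n) →
       length (filter (λ v → p v Bool.≟ true) (tabulate f)) ≡ count (p ∘ f)
  go zero    f = refl
  go (suc k) f with p (f fzero)
  ... | true  = cong suc (go k (f ∘ fsuc))
  ... | false = go k (f ∘ fsuc)

count-true : ∀ n → count {n} (λ _ → true) ≡ n
count-true zero    = refl
count-true (suc n) = cong suc (count-true n)

sum-supported : ∀ {n} (f : Fin n → ℕ) (a : Fin n) → (∀ v → v ≢ a → f v ≡ 0) → sum f ≡ f a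
sum-supported {suc n} f fzero     f0 =
  trans (cong (f fzero +_) (trans (sum-cong-≗ (λ v → f0 (fsuc v) λ ())) (sum-replicate-zero n)))
        (+-identityʳ _)
sum-supported {suc n} f (fsuc a) f0 =
  trans (cong (_+ sum (f ∘ fsuc)) (f0 fzero λ ()))
        (sum-supported (f ∘ fsuc) a (λ v v≢a → f0 (fsuc v) (v≢a ∘ suc-injective)))

sum-pick : ∀ {n} (f : Fin n → ℕ) (a : Fin n) → sum (λ v → if v == a then f v else 0) ≡ f a
sum-pick f a =
  trans (sum-supported _ a (λ v v≢a → cong (if_then f v else 0) (≢⇒==-false v≢a)))
        (cong (if_then f a else 0) (==-refl a))

count-split : ∀ {n} (p q : Fin n → Bool) →
              count p ≡ count (λ v → p v ∧ q v) + count (λ v → p v ∧ not (q v))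
count-split {n} p q = trans (sum-cong-≗ {n} pointwise) (∑-distrib-+ {n} _ _)
  where
  pointwise : ∀ v → indicator (p v) ≡ indicator (p v ∧ q v) + indicator (p v ∧ not (q v))
  pointwise v with p v | q v
  ... | false | _     = refl
  ... | true  | true  = refl
  ... | true  | false = refl

count-pair : ∀ {n} {x y : Fin n} → x ≢ y → count (λ v → (v == x) ∨ (v == y)) ≡ 2
count-pair {n} {x} {y} x≢y = begin
  count (λ v → (v == x) ∨ (v == y))                   ≡⟨ sum-cong-≗ {n} pointwise ⟩
  sum (λ v → indicator (v == x) + indicator (v == y)) ≡⟨ ∑-distrib-+ {n} _ _ ⟩
  count (_== x) + count (_== y)                       ≡⟨ cong₂ _+_ (sum-pick _ x) (sum-pick _ y) ⟩
  2                                                   ∎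
  where
  pointwise : ∀ v → indicator ((v == x) ∨ (v == y)) ≡ indicator (v == x) + indicator (v == y)
  pointwise v with v ≟ x
  ... | yes refl rewrite ≢⇒==-false x≢y = refl
  ... | no _     = refl

count-pos : ∀ {n} (p : Fin n → Bool) {x} → p x ≡ true → 1 ≤ count p
count-pos p {fzero}  px rewrite px = s≤s z≤n
count-pos p {fsuc x} px = ≤-trans (count-pos (p ∘ fsuc) px) (m≤n+m _ _)

two≤count : ∀ {n} (p : Fin n → Bool) {x y} → p x ≡ true → p y ≡ true → x ≢ y → 2 ≤ count p
two≤count p {x} {y} px py x≢y =
  subst (2 ≤_) (sym (count-split p (_== x)))
        (+-mono-≤ (count-pos _ {x} (cong₂ _∧_ px (==-refl x)))
                  (count-pos _ {y} (cong₂ (λ c d → c ∧ not d) py (≢⇒==-false (x≢y ∘ sym)))))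

count≡1-unique : ∀ {n} (p : Fin n → Bool) {x y} → count p ≡ 1 → p x ≡ true → y ≢ x → p y ≡ false
count≡1-unique p {x} {y} count≡1 px y≢x with p y in py
... | false = refl
... | true  with s≤s () ← subst (2 ≤_) count≡1 (two≤count p py px y≢x)

sum-split-core : ∀ {n} {a b : Fin n} → a ≢ b → (f : Fin n → ℕ) →
                 sum f ≡ f a + (f b + sum (λ v → if isTail a b v then f v else 0))
sum-split-core {n} {a} {b} a≢b f = begin
  sum f                                      ≡⟨ sum-cong-≗ {n} pointwise ⟩
  sum (λ v → at a v + (at b v + onTail v))   ≡⟨ ∑-distrib-+ {n} _ _ ⟩
  sum (at a) + sum (λ v → at b v + onTail v) ≡⟨ cong (sum (at a) +_) (∑-distrib-+ {n} _ _) ⟩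
  sum (at a) + (sum (at b) + sum onTail)     ≡⟨ cong₂ (λ x y → x + (y + sum onTail))
                                                      (sum-pick f a) (sum-pick f b) ⟩
  f a + (f b + sum onTail)                   ∎
  where
  at : Fin n → Fin n → ℕ
  at c v = if v == c then f v else 0
  onTail : Fin n → ℕ
  onTail v = if isTail a b v then f v else 0
  pointwise : ∀ v → f v ≡ (if v == a then f v else 0) + ((if v == b then f v else 0) +
                           (if isTail a b v then f v else 0))
  pointwise v with v ≟ a | v ≟ b
  ... | yes refl | yes refl = contradiction refl a≢b
  ... | yes refl | no _     = sym (+-identityʳ (f v))
  ... | no _     | yes refl = sym (+-identityʳ (f v))
  ... | no _     | no _     = refl

degreeSum : ∀ {n} → Graph n → ℕ
degreeSum G = sum (λ v → count (G v))

record TwoTreeProperties {n} (G : Graph n) : Set where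
  field
    symmetric   : ∀ u v → G u v ≡ G v u
    irreflexive : ∀ u → G u u ≡ false
    inTriangle  : ∀ u → ∃₂ λ y z → G u y ≡ true × G u z ≡ true × G y z ≡ true
    handshake   : degreeSum G + 6 ≡ 4 * n

K₃-properties : TwoTreeProperties K₃
K₃-properties = record
  { symmetric   = λ u v → cong not (==-sym u v)
  ; irreflexive = λ u → cong not (==-refl u)
  ; inTriangle  = K₃-triangle
  ; handshake   = refl
  }
  where
  K₃-triangle : ∀ u → ∃₂ λ y z → K₃ u y ≡ true × K₃ u z ≡ true × K₃ y z ≡ true
  K₃-triangle fzero               = fsuc fzero , fsuc (fsuc fzero) , refl , refl , refl
  K₃-triangle (fsuc fzero)        = fzero , fsuc (fsuc fzero) , refl , refl , refl
  K₃-triangle (fsuc (fsuc fzero)) = fzero , fsuc fzero , refl , refl , refl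

degreeSum-extend : ∀ {n} (G : Graph n) {x y : Fin n} → x ≢ y →
                   degreeSum (extend G x y) ≡ 4 + degreeSum G
degreeSum-extend {n} G x≢y =
  cong₂ _+_ (count-pair x≢y) (trans (∑-distrib-+ {n} _ _) (cong (_+ degreeSum G) (count-pair x≢y)))

extend-properties : ∀ {n} {G : Graph n} → TwoTreeProperties G →
                    ∀ {x y} → G x y ≡ true → TwoTreeProperties (extend G x y)
extend-properties {n} {G} P {x} {y} Gxy = record
  { symmetric   = symmetric′
  ; irreflexive = irreflexive′
  ; inTriangle  = inTriangle′
  ; handshake   = handshake′
  }
  where
  open TwoTreeProperties P
  E = extend G x y

  symmetric′ : ∀ u v → E u v ≡ E v u
  symmetric′ fzero    fzero    = refl
  symmetric′ fzero    (fsuc v) = refl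
  symmetric′ (fsuc u) fzero    = refl
  symmetric′ (fsuc u) (fsuc v) = symmetric u v

  irreflexive′ : ∀ u → E u u ≡ false
  irreflexive′ fzero    = refl
  irreflexive′ (fsuc u) = irreflexive u

  inTriangle′ : ∀ u → ∃₂ λ v w → E u v ≡ true × E u w ≡ true × E v w ≡ true
  inTriangle′ fzero = fsuc x , fsuc y ,
    cong (_∨ (x == y)) (==-refl x) , trans (cong ((y == x) ∨_) (==-refl y)) (∨-zeroʳ _) , Gxy
  inTriangle′ (fsuc u) with inTriangle u
  ... | v , w , uv , uw , vw = fsuc v , fsuc w , uv , uw , vw

  x≢y : x ≢ y
  x≢y refl with () ← trans (sym Gxy) (irreflexive x)

  handshake′ : degreeSum E + 6 ≡ 4 * suc n
  handshake′ = begin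
    degreeSum E + 6       ≡⟨ cong (_+ 6) (degreeSum-extend G x≢y) ⟩
    4 + (degreeSum G + 6) ≡⟨ cong (4 +_) handshake ⟩
    4 + 4 * n             ≡⟨ *-suc 4 n ⟨
    4 * suc n             ∎

twoTreeC-properties : ∀ {n} {G : Graph n} → TwoTreeC n G → TwoTreeProperties G
twoTreeC-properties triangle        = K₃-properties
twoTreeC-properties (add t x y Gxy) = extend-properties (twoTreeC-properties t) Gxy

degreeSum-relabel : ∀ {n} {G H : Graph n} (σ : Permutation′ n) →
                    (∀ u v → G (σ ⟨$⟩ʳ u) (σ ⟨$⟩ʳ v) ≡ H u v) → degreeSum G ≡ degreeSum H
degreeSum-relabel {n} {G} {H} σ iso = begin
  sum (λ u → count (G u))             ≡⟨ ∑-permute _ σ ⟩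
  sum (λ u → count (G (σ ⟨$⟩ʳ u)))    ≡⟨ sum-cong-≗ {n} (λ u → trans (∑-permute _ σ)
                                           (sum-cong-≗ {n} (λ v → cong indicator (iso u v)))) ⟩
  degreeSum H                         ∎

relabel-properties : ∀ {n} {G H : Graph n} (σ : Permutation′ n) →
                     (∀ u v → G (σ ⟨$⟩ʳ u) (σ ⟨$⟩ʳ v) ≡ H u v) →
                     TwoTreeProperties H → TwoTreeProperties G
relabel-properties {n} {G} {H} σ iso P = record
  { symmetric   = λ u v → trans (G≡H u v) (trans (symmetric _ _) (sym (G≡H v u)))
  ; irreflexive = λ u → trans (G≡H u u) (irreflexive _)
  ; inTriangle  = inTriangle′
  ; handshake   = trans (cong (_+ 6) (degreeSum-relabel σ iso)) handshake
  }
  where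
  open TwoTreeProperties P

  G≡H : ∀ u v → G u v ≡ H (σ ⟨$⟩ˡ u) (σ ⟨$⟩ˡ v)
  G≡H u v = trans (sym (cong₂ G (inverseʳ σ) (inverseʳ σ))) (iso _ _)

  inTriangle′ : ∀ u → ∃₂ λ y z → G u y ≡ true × G u z ≡ true × G y z ≡ true
  inTriangle′ u with inTriangle (σ ⟨$⟩ˡ u)
  ... | y , z , uy , uz , yz =
    σ ⟨$⟩ʳ y , σ ⟨$⟩ʳ z ,
    trans (G≡H u _) (trans (cong (H _) (inverseˡ σ)) uy) ,
    trans (G≡H u _) (trans (cong (H _) (inverseˡ σ)) uz) ,
    trans (iso y z) yz

isTwoTree-properties : ∀ {n} {G : Graph n} → IsTwoTree G → TwoTreeProperties G
isTwoTree-properties (σ , H , construction , iso) =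
  relabel-properties σ iso (twoTreeC-properties construction)

private
  handshake-cancel : ∀ d t → d + (d + (t + t + 2)) + 6 ≡ 4 * (2 + t) → d ≡ t
  handshake-cancel d t eq =
    *-cancelˡ-≡ d t 2 (+-cancelʳ-≡ (2 * t + 8) (2 * d) (2 * t)
                                  (trans (lhs d t) (trans eq (rhs t))))
    where
    lhs : ∀ d t → 2 * d + (2 * t + 8) ≡ d + (d + (t + t + 2)) + 6
    lhs = solve-∀
    rhs : ∀ t → 4 * (2 + t) ≡ 2 * t + (2 * t + 8)
    rhs = solve-∀

module BicentralCore {n} {G : Graph n} (twoTree : TwoTreeProperties G)
                     {a b : Fin n} (core : StrongBicentralCore G a b) where
  open TwoTreeProperties twoTree
  open StrongBicentralCore core

  tail : Fin n → Bool
  tail = isTail a b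

  degree3 : Fin n → Bool
  degree3 v = ⌊ Data.Nat._≟_ (deg G v) 3 ⌋

  tailOfDegree3 : Fin n → Bool
  tailOfDegree3 v = tail v ∧ degree3 v

  tailNeighbour : Fin n → Fin n → Bool
  tailNeighbour c v = tail v ∧ G c v

  missedBy : Fin n → Fin n → Bool
  missedBy c v = tail v ∧ not (G c v)

  common : Fin n → Bool
  common v = tail v ∧ G a v ∧ G b v

  adjacent-≢ : ∀ {u v} → G u v ≡ true → u ≢ v
  adjacent-≢ {u} uv refl with () ← trans (sym uv) (irreflexive u)

  neighbour-≢ : ∀ {u v w} → G u v ≡ true → G u w ≡ false → v ≢ w
  neighbour-≢ uv uw refl with () ← trans (sym uv) uw

  vertexCount : n ≡ 2 + count tail
  vertexCount = trans (sym (count-true n)) (sum-split-core distinct (λ _ → 1))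

  degree-split : ∀ v → count (G v) ≡
                       indicator (G v a) + (indicator (G v b) + count (tailNeighbour v))
  degree-split v =
    trans (sum-split-core distinct _)
          (cong (λ s → indicator (G v a) + (indicator (G v b) + s))
                (sum-cong-≗ {n} (λ u → indicator-∧ (tail u) (G v u))))

  sameDegree : count (G a) ≡ count (G b)
  sameDegree = trans (sym (countV≡count (G a))) (trans sameDeg (countV≡count (G b)))

  tailDegree : ∀ {v} → tail v ≡ true → count (G v) ≡ 2 + indicator (degree3 v)
  tailDegree {v} tv =
    trans (sym (countV≡count (G v))) (twoOrThree (tailSet v (isTail-≢ˡ tv) (isTail-≢ʳ tv)))
    where
    twoOrThree : ∀ {d} → d ≡ 2 ⊎ d ≡ 3 → d ≡ 2 + indicator ⌊ Data.Nat._≟_ d 3 ⌋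
    twoOrThree (inj₁ refl) = refl
    twoOrThree (inj₂ refl) = refl

  tailDegree≤3 : ∀ {v} → tail v ≡ true → count (G v) ≤ 3
  tailDegree≤3 {v} tv = subst (_≤ 3) (sym (tailDegree tv)) (s≤s (s≤s (indicator≤1 (degree3 v))))

  degree≥4 : ∀ {y x z} → G y a ≡ true → G y b ≡ true → tail x ≡ true → tail z ≡ true →
             G y x ≡ true → G y z ≡ true → x ≢ z → 4 ≤ count (G y)
  degree≥4 {y} ya yb tx tz yx yz x≢z =
    subst (4 ≤_) (sym degree)
          (s≤s (s≤s (two≤count (tailNeighbour y) (cong₂ _∧_ tx yx) (cong₂ _∧_ tz yz) x≢z)))
    where
    degree : count (G y) ≡ 1 + (1 + count (tailNeighbour y))
    degree = trans (degree-split y)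
                   (cong₂ (λ s t → indicator s + (indicator t + count (tailNeighbour y))) ya yb)

  degreeSum-core : degreeSum G ≡
                   count (G a) + (count (G a) + (count tail + count tail + count tailOfDegree3))
  degreeSum-core =
    trans (sum-split-core distinct _)
          (cong₂ (λ d s → count (G a) + (d + s)) (sym sameDegree) tailDegreeSum)
    where
    pointwise : ∀ v → (if tail v then count (G v) else 0) ≡
                      indicator (tail v) + indicator (tail v) + indicator (tailOfDegree3 v)
    pointwise v with tail v in tv
    ... | true  = tailDegree tv
    ... | false = refl
    tailDegreeSum : sum (λ v → if tail v then count (G v) else 0) ≡
                    count tail + count tail + count tailOfDegree3
    tailDegreeSum =
      trans (sum-cong-≗ {n} pointwise)
            (trans (∑-distrib-+ {n} _ _) (cong (_+ count tailOfDegree3) (∑-distrib-+ {n} _ _)))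

  count≡1⇒adjacent : ∀ c {x y} → count (missedBy c) ≡ 1 →
                     missedBy c x ≡ true → tail y ≡ true → y ≢ x → G c y ≡ true
  count≡1⇒adjacent c {y = y} unique mx ty y≢x =
    not-injective (subst (λ t → t ∧ not (G c y) ≡ false) ty
                         (count≡1-unique (missedBy c) unique mx y≢x))

  module _ (twoOfDegree3 : count tailOfDegree3 ≡ 2) where

    coreDegree : count (G a) ≡ count tail
    coreDegree = handshake-cancel d t (begin
      d + (d + (t + t + 2)) + 6
        ≡⟨ cong (λ k → d + (d + (t + t + k)) + 6) twoOfDegree3 ⟨
      d + (d + (t + t + count tailOfDegree3)) + 6 ≡⟨ cong (_+ 6) degreeSum-core ⟨
      degreeSum G + 6                             ≡⟨ handshake ⟩
      4 * n                                       ≡⟨ cong (4 *_) vertexCount ⟩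
      4 * (2 + t)                                 ∎)
      where
      d = count (G a)
      t = count tail

    uniqueMissed : ∀ c → count (G c) ≡ count tail → indicator (G c a) + indicator (G c b) ≡ 1 →
                   count (missedBy c) ≡ 1
    uniqueMissed c degree≡tail coreNeighbours = +-cancelˡ-≡ k _ _ (begin
      k + count (missedBy c)                      ≡⟨ count-split tail (G c) ⟨
      count tail                                  ≡⟨ degree≡tail ⟨
      count (G c)                                 ≡⟨ degree-split c ⟩
      indicator (G c a) + (indicator (G c b) + k) ≡⟨ +-assoc (indicator (G c a)) _ _ ⟨
      indicator (G c a) + indicator (G c b) + k   ≡⟨ cong (_+ k) coreNeighbours ⟩
      1 + k                                       ≡⟨ +-comm 1 k ⟩
      k + 1                                       ∎)
      where
      k = count (tailNeighbour c)

    uniqueMissedᵃ : count (missedBy a) ≡ 1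
    uniqueMissedᵃ = uniqueMissed a coreDegree
      (cong₂ (λ s t → indicator s + indicator t) (irreflexive a) strong)

    uniqueMissedᵇ : count (missedBy b) ≡ 1
    uniqueMissedᵇ = uniqueMissed b (trans (sym sameDegree) coreDegree)
      (cong₂ (λ s t → indicator s + indicator t) (trans (symmetric b a) strong) (irreflexive b))

    noTailMissesBoth : ∀ {x} → tail x ≡ true → G a x ≡ false → G b x ≡ false → ⊥
    noTailMissesBoth {x} tx ax bx = triangleContradiction (inTriangle x)
      where
      xa = trans (symmetric x a) ax
      xb = trans (symmetric x b) bx
      triangleContradiction : (∃₂ λ y z → G x y ≡ true × G x z ≡ true × G y z ≡ true) → ⊥
      triangleContradiction (y , z , xy , xz , yz) =
        <-irrefl refl (≤-trans (degree≥4 ya yb tx tz (trans (symmetric y x) xy) yz (adjacent-≢ xz))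
                               (tailDegree≤3 ty))
        where
        ty = ≢⇒isTail (neighbour-≢ xy xa) (neighbour-≢ xy xb)
        tz = ≢⇒isTail (neighbour-≢ xz xa) (neighbour-≢ xz xb)
        y≢x = adjacent-≢ xy ∘ sym
        ya = trans (symmetric y a)
                   (count≡1⇒adjacent a uniqueMissedᵃ (cong₂ (λ s t → s ∧ not t) tx ax) ty y≢x)
        yb = trans (symmetric y b)
                   (count≡1⇒adjacent b uniqueMissedᵇ (cong₂ (λ s t → s ∧ not t) tx bx) ty y≢x)

    tailCount : count tail ≡ count common + 2
    tailCount = begin
      count tail
        ≡⟨ sum-cong-≗ {n} pointwise ⟩
      sum (λ v → indicator (common v) + (indicator (missedBy a v) + indicator (missedBy b v)))
        ≡⟨ trans (∑-distrib-+ {n} _ _) (cong (count common +_) (∑-distrib-+ {n} _ _)) ⟩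
      count common + (count (missedBy a) + count (missedBy b))
        ≡⟨ cong₂ (λ s t → count common + (s + t)) uniqueMissedᵃ uniqueMissedᵇ ⟩
      count common + 2
        ∎
      where
      pointwise : ∀ v → indicator (tail v) ≡
                        indicator (common v) + (indicator (missedBy a v) + indicator (missedBy b v))
      pointwise v with tail v in tv | G a v in av | G b v in bv
      ... | false | _     | _     = refl
      ... | true  | true  | true  = refl
      ... | true  | true  | false = refl
      ... | true  | false | true  = refl
      ... | true  | false | false = ⊥-elim (noTailMissesBoth tv av bv)

    commonCount : count common + 4 ≡ n
    commonCount = begin
      count common + 4         ≡⟨ +-comm (count common) 4 ⟩
      2 + (2 + count common)   ≡⟨ cong (2 +_) (+-comm 2 (count common)) ⟩
      2 + (count common + 2)   ≡⟨ cong (2 +_) tailCount ⟨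
      2 + count tail           ≡⟨ vertexCount ⟨
      n                        ∎

lemma4p7 : (n : ℕ) → 6 ≤ n → (G : Graph n) → IsTwoTree G →
    (a b : Fin n) → StrongBicentralCore G a b →
    countV (λ v → isTail a b v ∧ ⌊ Data.Nat._≟_ (deg G v) 3 ⌋) ≡ 2 →
    countV (λ v → isTail a b v ∧ G a v ∧ G b v) ≡ n ∸ 4
lemma4p7 n _ G isTwoTree a b core twoOfDegree3 = begin
  countV common          ≡⟨ countV≡count common ⟩
  count common           ≡⟨ m+n∸n≡m (count common) 4 ⟨
  count common + 4 ∸ 4   ≡⟨ cong (_∸ 4) (commonCount (trans (sym (countV≡count tailOfDegree3))
                                                            twoOfDegree3)) ⟩
  n ∸ 4                  ∎
  where
  open BicentralCore (isTwoTree-properties isTwoTree) core
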